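{- Let $\mathcal{RAP}$ be the set of all reduced anti-palindromic compositions (of all weights $n\ge 0$). Then $$\sum_{\sigma\in \mathcal{RAP}}x^{|\sigma|}y^{\mathrm{parts}(\sigma)}=\frac{1 - x - x^2 + x^3 + x y - x^3 y}{1 - x - x^2 + x^3 - x^3 y^2}.$$
   Context: A composition of $n\ge0$ is a finite sequence $\sigma=(\sigma_1,\dots,\sigma_\ell)$ of positive integers summing to $n$; $|\sigma|=n$ and $\mathrm{parts}(\sigma)=\ell$ (the empty composition is the composition of $0$). A composition is anti-palindromic if $\sigma_i\neq\sigma_{\ell+1-i}$ for all $i$ with $i\neq(\ell+1)/2$. Two anti-palindromic compositions with $\ell$ parts are flip-equivalent if one is obtained from the other by swapping the entries $\sigma_i$ and $\sigma_{\ell+1-i}$ for some set of indices $i<(\ell+1)/2$. A reduced anti-palindromic composition is a flip-equivalence class; its weight and number of parts are those of any of its members. -}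

module Defs where

open import Data.Nat using (ℕ; zero; suc; _<_; _≤ᵇ_; _≡ᵇ_; _∸_)
open import Data.Integer using (ℤ; +_; -[1+_]; _*_; _+_)
import Data.Integer as ℤ
open import Data.Bool using (Bool; true; false; if_then_else_; _∧_)
open import Data.Fin using (Fin; toℕ; opposite)
open import Data.Vec using (Vec; lookup; sum)
open import Data.List using (List; []; _∷_; length)
open import Data.List.Relation.Unary.All using (All)
open import Data.List.Relation.Unary.Any using (Any)
open import Data.List.Relation.Unary.AllPairs using (AllPairs)
open import Data.Product using (Σ; _×_)
open import Relation.Binary.PropositionalEquality using (_≡_; _≢_)
open import Relation.Nullary using (¬_)

IsComposition : ∀ {ℓ} → ℕ → Vec ℕ ℓ → Set
IsComposition n v = (∀ i → 0 < lookup v i) × sum v ≡ n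

-- Anti-palindromic: σ_i ≠ σ_{ℓ+1-i} whenever i is not the middle index
-- (0-indexed: opposite i = ℓ-1-i).
AntiPalindromic : ∀ {ℓ} → Vec ℕ ℓ → Set
AntiPalindromic v = ∀ i → toℕ i ≢ toℕ (opposite i) → lookup v i ≢ lookup v (opposite i)

lowerIndex : ∀ {ℓ} → Fin ℓ → Fin ℓ
lowerIndex i = if toℕ i ≤ᵇ toℕ (opposite i) then i else opposite i

-- Flip-equivalence: w is obtained from v by swapping σ_i and σ_{ℓ+1-i}
-- for the indices i (in the first half) belonging to some set S.
FlipEquiv : ∀ {ℓ} → Vec ℕ ℓ → Vec ℕ ℓ → Set
FlipEquiv {ℓ} v w =
  Σ (Fin ℓ → Bool) λ S →
    ∀ i → lookup w i ≡ (if S (lowerIndex i) then lookup v (opposite i) else lookup v i)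

-- r is the number of reduced anti-palindromic compositions (flip-equivalence
-- classes of anti-palindromic compositions) of weight n with ℓ parts:
-- there is a list of r pairwise non-equivalent anti-palindromic compositions
-- of n with ℓ parts meeting every class.
IsRAPCount : ℕ → ℕ → ℕ → Set
IsRAPCount n ℓ r =
  Σ (List (Vec ℕ ℓ)) λ L →
    length L ≡ r
    × All (λ v → IsComposition n v × AntiPalindromic v) L
    × AllPairs (λ v w → ¬ FlipEquiv v w) L
    × (∀ (v : Vec ℕ ℓ) → IsComposition n v → AntiPalindromic v → Any (FlipEquiv v) L)

-- Bivariate polynomials in x,y with integer coefficients, as lists of
-- monomials (c , a , b) meaning c x^a y^b.
record Monomial : Set where
  constructor mono
  field
    coef : ℤ
    xdeg : ℕ
    ydeg : ℕ

Poly : Set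
Poly = List Monomial

polyCoeff : Poly → ℕ → ℕ → ℤ
polyCoeff [] n k = + 0
polyCoeff (mono c a b ∷ P) n k =
  (if (a ≡ᵇ n) ∧ (b ≡ᵇ k) then c else + 0) + polyCoeff P n k

-- coefficient of x^n y^k in the formal power series x^a y^b · F,
-- where F is given by its coefficient function
shiftCoeff : ℕ → ℕ → (ℕ → ℕ → ℤ) → ℕ → ℕ → ℤ
shiftCoeff a b F n k = if (a ≤ᵇ n) ∧ (b ≤ᵇ k) then F (n ∸ a) (k ∸ b) else + 0

mulCoeff : Poly → (ℕ → ℕ → ℤ) → ℕ → ℕ → ℤ
mulCoeff [] F n k = + 0
mulCoeff (mono c a b ∷ P) F n k = c * shiftCoeff a b F n k + mulCoeff P F n k

numerator : Poly
numerator = mono (+ 1) 0 0 ∷ mono (ℤ.- (+ 1)) 1 0 ∷ mono (ℤ.- (+ 1)) 2 0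
          ∷ mono (+ 1) 3 0 ∷ mono (+ 1) 1 1 ∷ mono (ℤ.- (+ 1)) 3 1 ∷ []

denominator : Poly
denominator = mono (+ 1) 0 0 ∷ mono (ℤ.- (+ 1)) 1 0 ∷ mono (ℤ.- (+ 1)) 2 0
            ∷ mono (+ 1) 3 0 ∷ mono (ℤ.- (+ 1)) 3 2 ∷ []

{-# OPTIONS --safe #-}
-- Removing the outer pair (σ₁, σ_ℓ) of an anti-palindromic composition leaves two distinct
-- positive parts and an anti-palindromic composition with two parts fewer, and a flip acts on
-- the outer pair independently of the inner ones.  So a reduced class with ℓ + 2 parts is a
-- pair 1 ≤ a < b together with a reduced class with ℓ parts, and
--   r(n, ℓ + 2) = Σ_{1 ≤ a < b} r(n − a − b, ℓ).
-- The pairs a < b with a + b = s are counted by x³ / ((1 − x)(1 − x²)), whose denominator is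
-- 1 − x − x² + x³; with r(n, 0) = [n = 0] and r(n, 1) = [n ≥ 1] this gives D · R = N.
-- Constructively the classes are realised by an explicit list of representatives built by
-- recursion on ℓ, and by pigeonhole any two lists as in IsRAPCount have the same length.
module Submission where

open import Defs
open import Data.Nat using (ℕ; zero; suc; _+_; _∸_; _≤_; _<_; _≤ᵇ_; z≤n; s≤s)
open import Data.Nat.Properties
  using ( ≤-antisym; ≤ᵇ-reflects-≤; ≤-total; suc-injective; +-assoc; +-comm; +-suc; +-identityʳ
        ; m<n⇒m<1+n; <-trans; <⇒≢; <-asym; <-cmp)
import Data.Nat.Tactic.RingSolver as ℕ-Solver
open import Data.Integer as ℤ using (ℤ; +_; 0ℤ)
open import Data.Integer.Properties using (pos-+; i≡j⇒i-j≡0)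
import Data.Integer.Tactic.RingSolver as ℤ-Solver
open import Data.Bool using (Bool; true; false; if_then_else_; _xor_; _∧_)
open import Data.Fin using (Fin; zero; suc; toℕ; opposite; inject₁; fromℕ)
open import Data.Fin.Properties using (toℕ-injective; opposite-involutive; toℕ-inject₁)
open import Data.Fin.Relation.Unary.Top using (view; ‵fromℕ; ‵inject₁)
open import Data.Vec using (Vec; []; _∷_; _∷ʳ_; lookup; sum; tabulate; initLast)
open import Data.Vec.Properties using (lookup∘tabulate)
open import Data.List using (List; []; _∷_; _++_; map; length)
open import Data.List.Properties using (length-++; length-map)
open import Data.List.Fresh as Fresh using (fromList)
import Data.List.Fresh.Relation.Unary.Any as Fresh
open import Data.List.Fresh.Membership.Setoid.Properties using (injection)
open import Data.List.Membership.Propositional using (_∈_; find; lose)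
open import Data.List.Membership.Propositional.Properties using (∈-map⁺; ∈-++⁺ˡ; ∈-++⁺ʳ)
open import Data.List.Relation.Unary.All as All using (All; []; _∷_)
import Data.List.Relation.Unary.All.Properties as All
open import Data.List.Relation.Unary.Any as Any using (Any; here; there)
open import Data.List.Relation.Unary.AllPairs as AllPairs using (AllPairs; []; _∷_)
import Data.List.Relation.Unary.AllPairs.Properties as AllPairs
open import Data.Product using (Σ; Σ-syntax; _×_; _,_; uncurry; curry)
open import Data.Sum using (inj₁; inj₂)
open import Data.Unit using (⊤; tt)
open import Function using (_∘_; id; _⇔_; mk⇔; Equivalence)
open import Relation.Binary.Bundles using (Setoid)
open import Relation.Binary.Definitions using (tri<; tri≈; tri>)
open import Relation.Binary.PropositionalEquality
open import Relation.Nullary using (¬_)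
open import Relation.Nullary.Negation using (contradiction)
open import Relation.Nullary.Reflects using (ofʸ; ofⁿ)

module _ {A : Set} where

  lookup-∷ʳ-inject₁ : ∀ {n} (v : Vec A n) b j → lookup (v ∷ʳ b) (inject₁ j) ≡ lookup v j
  lookup-∷ʳ-inject₁ (x ∷ v) b zero    = refl
  lookup-∷ʳ-inject₁ (x ∷ v) b (suc j) = lookup-∷ʳ-inject₁ v b j

  lookup-∷ʳ-fromℕ : ∀ {n} (v : Vec A n) b → lookup (v ∷ʳ b) (fromℕ n) ≡ b
  lookup-∷ʳ-fromℕ []      b = refl
  lookup-∷ʳ-fromℕ (x ∷ v) b = lookup-∷ʳ-fromℕ v b

sum-∷ʳ : ∀ {n} (v : Vec ℕ n) b → sum (v ∷ʳ b) ≡ sum v + b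
sum-∷ʳ []      b = +-identityʳ b
sum-∷ʳ (x ∷ v) b = trans (cong (_+_ x) (sum-∷ʳ v b)) (sym (+-assoc x (sum v) b))

opposite-inject₁ : ∀ {n} (j : Fin n) → opposite (inject₁ j) ≡ suc (opposite j)
opposite-inject₁ {suc n} zero    = refl
opposite-inject₁ {suc n} (suc j) = cong inject₁ (opposite-inject₁ j)

opposite-fromℕ : ∀ n → opposite (fromℕ n) ≡ zero
opposite-fromℕ zero    = refl
opposite-fromℕ (suc n) = cong inject₁ (opposite-fromℕ n)

suc≤ᵇsuc : ∀ m n → (suc m ≤ᵇ suc n) ≡ (m ≤ᵇ n)
suc≤ᵇsuc zero    n = refl
suc≤ᵇsuc (suc m) n = refl

allPairs-mapWithAll : ∀ {A : Set} {P : A → Set} {R S : A → A → Set} {xs} →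
  (∀ {x y} → P x → P y → R x y → S x y) → All P xs → AllPairs R xs → AllPairs S xs
allPairs-mapWithAll f []         []         = []
allPairs-mapWithAll f (px ∷ pxs) (rx ∷ rxs) =
  All.zipWith (λ (py , r) → f px py r) (pxs , rx) ∷ allPairs-mapWithAll f pxs rxs

module _ {a r} {A : Set a} {R : A → A → Set r} where

  length-fromList : ∀ {xs} (rs : AllPairs R xs) → Fresh.length (fromList rs) ≡ length xs
  length-fromList []       = refl
  length-fromList (_ ∷ rs) = cong suc (length-fromList rs)

  fromList-Any⁻ : ∀ {p} {P : A → Set p} {xs} (rs : AllPairs R xs) → Fresh.Any P (fromList rs) → Any P xs
  fromList-Any⁻ (_ ∷ rs) (Fresh.here p)  = here p
  fromList-Any⁻ (_ ∷ rs) (Fresh.there p) = there (fromList-Any⁻ rs p)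

  fromList-Any⁺ : ∀ {p} {P : A → Set p} {xs} (rs : AllPairs R xs) → Any P xs → Fresh.Any P (fromList rs)
  fromList-Any⁺ (_ ∷ rs) (here p)  = Fresh.here p
  fromList-Any⁺ (_ ∷ rs) (there p) = Fresh.there (fromList-Any⁺ rs p)

module _ {c r} (S : Setoid c r) where

  open Setoid S using (_≈_; _≉_) renaming (trans to ≈-trans)

  length-≤-of-covered : ∀ xs ys → AllPairs _≉_ xs → AllPairs _≉_ ys →
    All (λ x → Any (x ≈_) ys) xs → length xs ≤ length ys
  length-≤-of-covered _ _ xs-distinct ys-distinct covered =
    subst₂ _≤_ (length-fromList xs-distinct) (length-fromList ys-distinct)
      (injection S id inclusion)
    where
    inclusion : ∀ {x} → Fresh.Any (x ≈_) (fromList xs-distinct) → Fresh.Any (x ≈_) (fromList ys-distinct)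
    inclusion x∈xs with find (fromList-Any⁻ xs-distinct x∈xs)
    ... | x′ , x′∈xs , x≈x′ =
      fromList-Any⁺ ys-distinct (Any.map (≈-trans x≈x′) (All.lookup covered x′∈xs))

-- Flip equivalence

lowerIndex-opposite : ∀ {ℓ} (i : Fin ℓ) → lowerIndex (opposite i) ≡ lowerIndex i
lowerIndex-opposite i
  rewrite opposite-involutive i
  with toℕ i ≤ᵇ toℕ (opposite i) | ≤ᵇ-reflects-≤ (toℕ i) (toℕ (opposite i))
     | toℕ (opposite i) ≤ᵇ toℕ i | ≤ᵇ-reflects-≤ (toℕ (opposite i)) (toℕ i)
... | true  | ofʸ i≤o | true  | ofʸ o≤i = toℕ-injective (≤-antisym o≤i i≤o)
... | true  | _       | false | _       = refl
... | false | _       | true  | _       = refl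
... | false | ofⁿ i≰o | false | ofⁿ o≰i with ≤-total (toℕ i) (toℕ (opposite i))
...   | inj₁ i≤o = contradiction i≤o i≰o
...   | inj₂ o≤i = contradiction o≤i o≰i

SwapEquation : ∀ {ℓ} → (Fin ℓ → Bool) → Vec ℕ ℓ → Vec ℕ ℓ → Fin ℓ → Set
SwapEquation S v w i = lookup w i ≡ (if S (lowerIndex i) then lookup v (opposite i) else lookup v i)

module _ {ℓ} {S : Fin ℓ → Bool} {v w : Vec ℕ ℓ} where

  swapEquation-opposite : (∀ i → SwapEquation S v w i) → ∀ i →
    lookup w (opposite i) ≡ (if S (lowerIndex i) then lookup v i else lookup v (opposite i))
  swapEquation-opposite swap i = begin
    lookup w (opposite i)
      ≡⟨ swap (opposite i) ⟩
    (if S (lowerIndex (opposite i)) then lookup v (opposite (opposite i)) else lookup v (opposite i))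
      ≡⟨ cong₂ (λ k j → if S k then lookup v j else lookup v (opposite i))
               (lowerIndex-opposite i) (opposite-involutive i) ⟩
    (if S (lowerIndex i) then lookup v i else lookup v (opposite i)) ∎
    where open ≡-Reasoning

FlipEquiv-refl : ∀ {ℓ} (v : Vec ℕ ℓ) → FlipEquiv v v
FlipEquiv-refl v = (λ _ → false) , λ _ → refl

FlipEquiv-sym : ∀ {ℓ} {v w : Vec ℕ ℓ} → FlipEquiv v w → FlipEquiv w v
FlipEquiv-sym {v = v} {w} (S , swap) = S , swap⁻¹
  where
  swap⁻¹ : ∀ i → SwapEquation S w v i
  swap⁻¹ i with S (lowerIndex i) | swap i | swapEquation-opposite {S = S} {v} {w} swap i
  ... | true  | _     | w∘o≡v = sym w∘o≡v
  ... | false | w≡v   | _     = sym w≡v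

FlipEquiv-trans : ∀ {ℓ} {u v w : Vec ℕ ℓ} → FlipEquiv u v → FlipEquiv v w → FlipEquiv u w
FlipEquiv-trans {u = u} {v} {w} (S , swap) (T , swap′) = (λ k → S k xor T k) , composite
  where
  composite : ∀ i → SwapEquation (λ k → S k xor T k) u w i
  composite i with S (lowerIndex i) | T (lowerIndex i) | swap i
                 | swapEquation-opposite {S = S} {u} {v} swap i | swap′ i
  ... | true  | true  | _   | v∘o≡u | w≡v∘o = trans w≡v∘o v∘o≡u
  ... | true  | false | v≡u | _     | w≡v   = trans w≡v v≡u
  ... | false | true  | _   | v∘o≡u | w≡v∘o = trans w≡v∘o v∘o≡u
  ... | false | false | v≡u | _     | w≡v   = trans w≡v v≡u

flipSetoid : ℕ → Setoid _ _
flipSetoid ℓ = record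
  { Carrier       = Vec ℕ ℓ
  ; _≈_           = FlipEquiv
  ; isEquivalence = record
    { refl  = λ {v} → FlipEquiv-refl v
    ; sym   = λ {v w} → FlipEquiv-sym {v = v} {w}
    ; trans = λ {u v w} → FlipEquiv-trans {u = u} {v} {w}
    }
  }

-- Splitting off the outer pair

record Framed (X : Set) : Set where
  constructor _◂_▸_
  field
    left  : ℕ
    inner : X
    right : ℕ

open Framed

surround : ∀ {ℓ} → Framed (Vec ℕ ℓ) → Vec ℕ (suc (suc ℓ))
surround (a ◂ v ▸ b) = a ∷ (v ∷ʳ b)

data Position {ℓ} : Fin (suc (suc ℓ)) → Set where
  outerLeft  : Position zero
  innerAt    : (j : Fin ℓ) → Position (suc (inject₁ j))
  outerRight : Position (suc (fromℕ ℓ))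

position : ∀ {ℓ} (i : Fin (suc (suc ℓ))) → Position i
position zero = outerLeft
position (suc i) with view i
... | ‵fromℕ     = outerRight
... | ‵inject₁ j = innerAt j

module _ {ℓ : ℕ} where

  opposite-outerRight : opposite {suc (suc ℓ)} (suc (fromℕ ℓ)) ≡ zero
  opposite-outerRight = cong inject₁ (opposite-fromℕ ℓ)

  opposite-innerAt : (j : Fin ℓ) → opposite {suc (suc ℓ)} (suc (inject₁ j)) ≡ suc (inject₁ (opposite j))
  opposite-innerAt j = cong inject₁ (opposite-inject₁ j)

  lowerIndex-innerAt : (j : Fin ℓ) →
    lowerIndex {suc (suc ℓ)} (suc (inject₁ j)) ≡ suc (inject₁ (lowerIndex j))
  lowerIndex-innerAt j
    rewrite opposite-innerAt j | toℕ-inject₁ j | toℕ-inject₁ (opposite j)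
          | suc≤ᵇsuc (toℕ j) (toℕ (opposite j))
    with toℕ j ≤ᵇ toℕ (opposite j)
  ... | true  = refl
  ... | false = refl

  lowerIndex-outerRight : lowerIndex {suc (suc ℓ)} (suc (fromℕ ℓ)) ≡ zero
  lowerIndex-outerRight rewrite opposite-outerRight = refl

module _ {ℓ} {a b c d : ℕ} {v w : Vec ℕ ℓ} where

  swapEquation-innerAt : (S : Fin (suc (suc ℓ)) → Bool) (S′ : Fin ℓ → Bool) →
    (∀ k → S (suc (inject₁ k)) ≡ S′ k) → ∀ j →
    SwapEquation S (surround (a ◂ v ▸ b)) (surround (c ◂ w ▸ d)) (suc (inject₁ j)) ⇔
    SwapEquation S′ v w j
  swapEquation-innerAt S S′ S≡S′ j
    rewrite lowerIndex-innerAt j | opposite-innerAt j | S≡S′ (lowerIndex j)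
          | lookup-∷ʳ-inject₁ v b j | lookup-∷ʳ-inject₁ v b (opposite j) | lookup-∷ʳ-inject₁ w d j
    = mk⇔ id id

  FlipEquiv-surround⁻ : FlipEquiv (surround (a ◂ v ▸ b)) (surround (c ◂ w ▸ d)) →
    Σ Bool λ t → c ≡ (if t then b else a) × d ≡ (if t then a else b) × FlipEquiv v w
  FlipEquiv-surround⁻ (S , swap) = S zero , firstEntry , lastEntry , (S ∘ suc ∘ inject₁ , swapInner)
    where
    firstEntry : c ≡ (if S zero then b else a)
    firstEntry = subst (λ z → c ≡ (if S zero then z else a)) (lookup-∷ʳ-fromℕ v b) (swap zero)
    lastEntry : d ≡ (if S zero then a else b)
    lastEntry = subst₂ (λ y z → y ≡ (if S zero then a else z))
      (lookup-∷ʳ-fromℕ w d) (lookup-∷ʳ-fromℕ v b)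
      (swapEquation-opposite {S = S} {surround (a ◂ v ▸ b)} {surround (c ◂ w ▸ d)} swap zero)
    swapInner : ∀ j → SwapEquation (S ∘ suc ∘ inject₁) v w j
    swapInner j = Equivalence.to (swapEquation-innerAt S _ (λ _ → refl) j) (swap (suc (inject₁ j)))

  FlipEquiv-surround⁺ : (t : Bool) → c ≡ (if t then b else a) → d ≡ (if t then a else b) →
    FlipEquiv v w → FlipEquiv (surround (a ◂ v ▸ b)) (surround (c ◂ w ▸ d))
  FlipEquiv-surround⁺ t c≡ d≡ (S′ , swap) = S , swapAt
    where
    -- The final entry is never read: lowerIndex only returns indices in the first half.
    S : Fin (suc (suc ℓ)) → Bool
    S = lookup (t ∷ (tabulate S′ ∷ʳ false))
    S≡S′ : ∀ k → S (suc (inject₁ k)) ≡ S′ k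
    S≡S′ k = trans (lookup-∷ʳ-inject₁ (tabulate S′) false k) (lookup∘tabulate S′ k)
    swapAt : ∀ i → SwapEquation S (surround (a ◂ v ▸ b)) (surround (c ◂ w ▸ d)) i
    swapAt i with position i
    ... | outerLeft  rewrite lookup-∷ʳ-fromℕ v b = c≡
    ... | innerAt j  = Equivalence.from (swapEquation-innerAt S S′ S≡S′ j) (swap j)
    ... | outerRight
      rewrite lowerIndex-outerRight {ℓ} | opposite-outerRight {ℓ}
            | lookup-∷ʳ-fromℕ w d | lookup-∷ʳ-fromℕ v b
      = d≡

AntiPalindromicAt : ∀ {ℓ} → Vec ℕ ℓ → Fin ℓ → Set
AntiPalindromicAt v i = toℕ i ≢ toℕ (opposite i) → lookup v i ≢ lookup v (opposite i)

module _ {ℓ} {a b : ℕ} {v : Vec ℕ ℓ} where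

  antiPalindromicAt-innerAt : ∀ j →
    AntiPalindromicAt (surround (a ◂ v ▸ b)) (suc (inject₁ j)) ⇔ AntiPalindromicAt v j
  antiPalindromicAt-innerAt j
    rewrite opposite-innerAt j | toℕ-inject₁ j | toℕ-inject₁ (opposite j)
          | lookup-∷ʳ-inject₁ v b j | lookup-∷ʳ-inject₁ v b (opposite j)
    = mk⇔ (λ ap j≢ → ap (j≢ ∘ suc-injective)) (λ ap j≢ → ap (j≢ ∘ cong suc))

  antiPalindromic-surround⁻ : AntiPalindromic (surround (a ◂ v ▸ b)) → a ≢ b × AntiPalindromic v
  antiPalindromic-surround⁻ ap =
    a≢b , λ j → Equivalence.to (antiPalindromicAt-innerAt j) (ap (suc (inject₁ j)))
    where
    a≢b : a ≢ b
    a≢b a≡b = ap zero (λ ()) (trans a≡b (sym (lookup-∷ʳ-fromℕ v b)))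

  antiPalindromic-surround⁺ : a ≢ b → AntiPalindromic v → AntiPalindromic (surround (a ◂ v ▸ b))
  antiPalindromic-surround⁺ a≢b ap i with position i
  ... | outerLeft  rewrite lookup-∷ʳ-fromℕ v b = λ _ → a≢b
  ... | innerAt j  = Equivalence.from (antiPalindromicAt-innerAt j) (ap j)
  ... | outerRight rewrite opposite-outerRight {ℓ} | lookup-∷ʳ-fromℕ v b = λ _ → a≢b ∘ sym

  sum-surround : sum (surround (a ◂ v ▸ b)) ≡ a + b + sum v
  sum-surround = begin
    a + sum (v ∷ʳ b)  ≡⟨ cong (_+_ a) (sum-∷ʳ v b) ⟩
    a + (sum v + b)   ≡⟨ cong (_+_ a) (+-comm (sum v) b) ⟩
    a + (b + sum v)   ≡⟨ +-assoc a b (sum v) ⟨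
    a + b + sum v     ∎
    where open ≡-Reasoning

  isComposition-surround⁻ : ∀ {n} → IsComposition n (surround (a ◂ v ▸ b)) →
    0 < a × 0 < b × IsComposition (sum v) v × a + b + sum v ≡ n
  isComposition-surround⁻ (positive , sum≡n) =
    positive zero ,
    subst (0 <_) (lookup-∷ʳ-fromℕ v b) (positive (suc (fromℕ ℓ))) ,
    ((λ j → subst (0 <_) (lookup-∷ʳ-inject₁ v b j) (positive (suc (inject₁ j)))) , refl) ,
    trans (sym sum-surround) sum≡n

  isComposition-surround⁺ : ∀ {m} → 0 < a → 0 < b → IsComposition m v →
    IsComposition (a + b + m) (surround (a ◂ v ▸ b))
  isComposition-surround⁺ 0<a 0<b (positive , sum≡m) =
    positiveAt , trans sum-surround (cong (_+_ (a + b)) sum≡m)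
    where
    positiveAt : ∀ i → 0 < lookup (surround (a ◂ v ▸ b)) i
    positiveAt i with position i
    ... | outerLeft  = 0<a
    ... | innerAt j  rewrite lookup-∷ʳ-inject₁ v b j = positive j
    ... | outerRight rewrite lookup-∷ʳ-fromℕ v b = 0<b

-- Enumerating outer pairs

module _ {X : Set} where

  widenRight widenBoth : Framed X → Framed X
  widenRight (a ◂ x ▸ b) = a ◂ x ▸ suc b
  widenBoth  (a ◂ x ▸ b) = suc a ◂ x ▸ suc b

  ValidFraming : (ℕ → X → Set) → ℕ → Framed X → Set
  ValidFraming P n (a ◂ x ▸ b) = 1 ≤ a × a < b × Σ[ m ∈ ℕ ] a + b + m ≡ n × P m x

  Separated : (X → X → Set) → Framed X → Framed X → Set
  Separated R f g = left f ≡ left g → right f ≡ right g → R (inner f) (inner g)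

weight-widenRight : ∀ a b m {n} → a + b + m ≡ n → a + suc b + m ≡ suc n
weight-widenRight a b m a+b+m≡n = trans (cong (_+ m) (+-suc a b)) (cong suc a+b+m≡n)

-- unitFramings n lists the a ◂ x ▸ b with 1 = a < b and x ∈ c (n − a − b), and
-- increasingFramings n those with 1 ≤ a < b, each exactly once.  Splitting off b = 2,
-- respectively a = 1, and widening the rest makes the lengths follow (1 − x)(1 − x²).
module Framings {X : Set} (c : ℕ → List X) where

  unitFramings : ℕ → List (Framed X)
  unitFramings (suc (suc (suc m))) = map (1 ◂_▸ 2) (c m) ++ map widenRight (unitFramings (suc (suc m)))
  unitFramings _                   = []

  increasingFramings : ℕ → List (Framed X)
  increasingFramings (suc (suc m)) = unitFramings (suc (suc m)) ++ map widenBoth (increasingFramings m)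
  increasingFramings _             = []

  module _ {P : ℕ → X → Set} (c-valid : ∀ m → All (P m) (c m)) where

    unitFramings-valid : ∀ n → All (λ f → left f ≡ 1 × ValidFraming P n f) (unitFramings n)
    unitFramings-valid zero                = []
    unitFramings-valid (suc zero)          = []
    unitFramings-valid (suc (suc zero))    = []
    unitFramings-valid (suc (suc (suc m))) = All.++⁺
      (All.gmap⁺ (λ p → refl , s≤s z≤n , s≤s (s≤s z≤n) , m , refl , p) (c-valid m))
      (All.gmap⁺ (λ { {a ◂ x ▸ b} (a≡1 , 1≤a , a<b , k , weight , p) →
                      a≡1 , 1≤a , m<n⇒m<1+n a<b , k , weight-widenRight a b k weight , p })
                 (unitFramings-valid (suc (suc m))))

    increasingFramings-valid : ∀ n → All (ValidFraming P n) (increasingFramings n)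
    increasingFramings-valid zero          = []
    increasingFramings-valid (suc zero)    = []
    increasingFramings-valid (suc (suc m)) = All.++⁺
      (All.map (λ (_ , valid) → valid) (unitFramings-valid (suc (suc m))))
      (All.gmap⁺ (λ { {a ◂ x ▸ b} (1≤a , a<b , k , weight , p) →
                      s≤s z≤n , s≤s a<b , k , cong suc (weight-widenRight a b k weight) , p })
                 (increasingFramings-valid m))

  unitFramings-complete : ∀ {x m} b → x ∈ c m →
    (1 ◂ x ▸ suc (suc b)) ∈ unitFramings (suc (suc (suc b)) + m)
  unitFramings-complete zero    x∈c = ∈-++⁺ˡ (∈-map⁺ (1 ◂_▸ 2) x∈c)
  unitFramings-complete (suc b) x∈c = ∈-++⁺ʳ _ (∈-map⁺ widenRight (unitFramings-complete b x∈c))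

  increasingFramings-complete : ∀ {x m} a b → 1 ≤ a → a < b → x ∈ c m →
    (a ◂ x ▸ b) ∈ increasingFramings (a + b + m)
  increasingFramings-complete 1 (suc (suc b)) _ _ x∈c = ∈-++⁺ˡ (unitFramings-complete b x∈c)
  increasingFramings-complete {x} {m} (suc (suc a)) (suc b) _ (s≤s a<b) x∈c =
    ∈-++⁺ʳ _ (∈-map⁺ widenBoth
      (subst (λ n → (suc a ◂ x ▸ b) ∈ increasingFramings n) (sym (cong (_+ m) (+-suc a b)))
        (increasingFramings-complete (suc a) b (s≤s z≤n) a<b x∈c)))
  increasingFramings-complete 1 1 _ (s≤s ()) _

  private
    trivial : ∀ m → All (λ _ → ⊤) (c m)
    trivial m = All.universal (λ _ → tt) (c m)

  module _ {R : X → X → Set} (c-separated : ∀ m → AllPairs R (c m)) where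

    unitFramings-separated : ∀ n → AllPairs (Separated R) (unitFramings n)
    unitFramings-separated zero                = []
    unitFramings-separated (suc zero)          = []
    unitFramings-separated (suc (suc zero))    = []
    unitFramings-separated (suc (suc (suc m))) = AllPairs.++⁺
      (AllPairs.map⁺ (AllPairs.map (λ r _ _ → r) (c-separated m)))
      (AllPairs.map⁺ (AllPairs.map (λ r a≡ b≡ → r a≡ (suc-injective b≡))
                                   (unitFramings-separated (suc (suc m)))))
      (All.map⁺ (All.universal (λ x → All.gmap⁺ (widerThan12 {x}) (unitFramings-valid trivial (suc (suc m))))
                               (c m)))
      where
      widerThan12 : ∀ {x f} → left f ≡ 1 × ValidFraming (λ _ _ → ⊤) (suc (suc m)) f →
        Separated R (1 ◂ x ▸ 2) (widenRight f)
      widerThan12 {f = _ ◂ _ ▸ _} (refl , _ , s≤s () , _) _ refl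

    increasingFramings-separated : ∀ n → AllPairs (Separated R) (increasingFramings n)
    increasingFramings-separated zero          = []
    increasingFramings-separated (suc zero)    = []
    increasingFramings-separated (suc (suc m)) = AllPairs.++⁺
      (unitFramings-separated (suc (suc m)))
      (AllPairs.map⁺ (AllPairs.map (λ r a≡ b≡ → r (suc-injective a≡) (suc-injective b≡))
                                   (increasingFramings-separated m)))
      (All.map (λ (a≡1 , _) → All.gmap⁺ (widerThanUnit a≡1) (increasingFramings-valid trivial m))
               (unitFramings-valid trivial (suc (suc m))))
      where
      widerThanUnit : ∀ {f g} → left f ≡ 1 → ValidFraming (λ _ _ → ⊤) m g → Separated R f (widenBoth g)
      widerThanUnit {g = _ ◂ _ ▸ _} refl (() , _) refl

  length-unitFramings : ∀ m → length (unitFramings (3 + m)) ≡ length (c m) + length (unitFramings (2 + m))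
  length-unitFramings m = begin
    length (map (1 ◂_▸ 2) (c m) ++ map widenRight (unitFramings (2 + m)))
      ≡⟨ length-++ (map (1 ◂_▸ 2) (c m)) ⟩
    length (map (1 ◂_▸ 2) (c m)) + length (map widenRight (unitFramings (2 + m)))
      ≡⟨ cong₂ _+_ (length-map (1 ◂_▸ 2) (c m)) (length-map widenRight (unitFramings (2 + m))) ⟩
    length (c m) + length (unitFramings (2 + m)) ∎
    where open ≡-Reasoning

  length-increasingFramings : ∀ m →
    length (increasingFramings (2 + m)) ≡ length (unitFramings (2 + m)) + length (increasingFramings m)
  length-increasingFramings m = begin
    length (unitFramings (2 + m) ++ map widenBoth (increasingFramings m))
      ≡⟨ length-++ (unitFramings (2 + m)) ⟩
    length (unitFramings (2 + m)) + length (map widenBoth (increasingFramings m))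
      ≡⟨ cong (_+_ (length (unitFramings (2 + m)))) (length-map widenBoth (increasingFramings m)) ⟩
    length (unitFramings (2 + m)) + length (increasingFramings m) ∎
    where open ≡-Reasoning

  length-increasingFramings-recurrence : ∀ m →
    length (increasingFramings (3 + m)) + length (increasingFramings m) ≡
    length (increasingFramings (2 + m)) + length (increasingFramings (1 + m)) + length (c m)
  length-increasingFramings-recurrence m = begin
    I (3 + m) + I m                    ≡⟨ cong (_+ I m) (length-increasingFramings (1 + m)) ⟩
    U (3 + m) + I (1 + m) + I m        ≡⟨ cong (λ u → u + I (1 + m) + I m) (length-unitFramings m) ⟩
    C m + U (2 + m) + I (1 + m) + I m  ≡⟨ rearrange (C m) (U (2 + m)) (I (1 + m)) (I m) ⟩
    U (2 + m) + I m + I (1 + m) + C m  ≡⟨ cong (λ i → i + I (1 + m) + C m) (length-increasingFramings m) ⟨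
    I (2 + m) + I (1 + m) + C m        ∎
    where
    open ≡-Reasoning
    I U C : ℕ → ℕ
    I n = length (increasingFramings n)
    U n = length (unitFramings n)
    C n = length (c n)
    rearrange : ∀ x y z t → x + y + z + t ≡ y + t + z + x
    rearrange = ℕ-Solver.solve-∀

-- Counting the classes

open Framings

representatives : (ℓ n : ℕ) → List (Vec ℕ ℓ)
representatives zero          zero    = [] ∷ []
representatives zero          (suc n) = []
representatives (suc zero)    zero    = []
representatives (suc zero)    (suc n) = (suc n ∷ []) ∷ []
representatives (suc (suc ℓ)) n       = map surround (increasingFramings (representatives ℓ) n)

IsAPComposition : ∀ {ℓ} → ℕ → Vec ℕ ℓ → Set
IsAPComposition n v = IsComposition n v × AntiPalindromic v

representatives-valid : ∀ ℓ n → All (IsAPComposition n) (representatives ℓ n)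
representatives-valid zero          zero    = (((λ ()) , refl) , (λ ())) ∷ []
representatives-valid zero          (suc n) = []
representatives-valid (suc zero)    zero    = []
representatives-valid (suc zero)    (suc n) =
  (((λ { zero → s≤s z≤n }) , +-identityʳ (suc n)) , (λ { zero 0≢0 → contradiction refl 0≢0 })) ∷ []
representatives-valid (suc (suc ℓ)) n       =
  All.gmap⁺ surround-valid (increasingFramings-valid (representatives ℓ) (representatives-valid ℓ) n)
  where
  surround-valid : ∀ {f} → ValidFraming IsAPComposition n f → IsAPComposition n (surround f)
  surround-valid {a ◂ v ▸ b} (0<a , a<b , m , weight , composition , antiPalindromic) =
    subst (λ k → IsComposition k (surround (a ◂ v ▸ b))) weight
      (isComposition-surround⁺ {v = v} 0<a (<-trans 0<a a<b) composition) ,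
    antiPalindromic-surround⁺ {v = v} (<⇒≢ a<b) antiPalindromic

representatives-inequivalent : ∀ ℓ n → AllPairs (λ v w → ¬ FlipEquiv v w) (representatives ℓ n)
representatives-inequivalent zero          zero    = [] ∷ []
representatives-inequivalent zero          (suc n) = []
representatives-inequivalent (suc zero)    zero    = []
representatives-inequivalent (suc zero)    (suc n) = [] ∷ []
representatives-inequivalent (suc (suc ℓ)) n       = AllPairs.map⁺ (allPairs-mapWithAll inequivalent
  (increasingFramings-valid (representatives ℓ) (representatives-valid ℓ) n)
  (increasingFramings-separated (representatives ℓ) (representatives-inequivalent ℓ) n))
  where
  inequivalent : ∀ {f g} → ValidFraming IsAPComposition n f → ValidFraming IsAPComposition n g →
    Separated (λ v w → ¬ FlipEquiv v w) f g → ¬ FlipEquiv (surround f) (surround g)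
  inequivalent {a ◂ v ▸ b} {c ◂ w ▸ d} (_ , a<b , _) (_ , c<d , _) separated equivalent
    with FlipEquiv-surround⁻ {v = v} {w} equivalent
  ... | false , c≡a , d≡b , inner≈ = separated (sym c≡a) (sym d≡b) inner≈
  ... | true  , c≡b , d≡a , _      = <-asym a<b (subst₂ _<_ c≡b d≡a c<d)

surround-representative : ∀ {ℓ m x y} {v w : Vec ℕ ℓ} → 0 < x → 0 < y → x ≢ y →
  w ∈ representatives ℓ m → FlipEquiv v w →
  Any (FlipEquiv (surround (x ◂ v ▸ y))) (representatives (suc (suc ℓ)) (x + y + m))
surround-representative {ℓ} {m} {x} {y} {v} {w} 0<x 0<y x≢y w∈ v≈w with <-cmp x y
... | tri< x<y _ _ = lose (∈-map⁺ surround (increasingFramings-complete (representatives ℓ) x y 0<x x<y w∈))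
                          (FlipEquiv-surround⁺ {v = v} {w} false refl refl v≈w)
... | tri≈ _ x≡y _ = contradiction x≡y x≢y
... | tri> _ _ y<x =
  subst (λ k → Any (FlipEquiv (surround (x ◂ v ▸ y))) (representatives (suc (suc ℓ)) (k + m))) (+-comm y x)
        (lose (∈-map⁺ surround (increasingFramings-complete (representatives ℓ) y x 0<y y<x w∈))
              (FlipEquiv-surround⁺ {v = v} {w} true refl refl v≈w))

representatives-complete : ∀ ℓ {n} (v : Vec ℕ ℓ) → IsAPComposition n v →
  Any (FlipEquiv v) (representatives ℓ n)
representatives-complete zero          []            ((_ , refl) , _)     = here (FlipEquiv-refl [])
representatives-complete (suc zero)    (zero ∷ [])   ((positive , _) , _) = contradiction (positive zero) (λ ())
representatives-complete (suc zero)    (suc k ∷ [])  ((_ , refl) , _)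
  rewrite +-identityʳ k = here (FlipEquiv-refl (suc k ∷ []))
representatives-complete (suc (suc ℓ)) (x ∷ xs) (composition , antiPalindromic) with initLast xs
... | ys , y , refl =
  let 0<x , 0<y , ys-composition , weight = isComposition-surround⁻ {v = ys} composition
      x≢y , ys-antiPalindromic           = antiPalindromic-surround⁻ {v = ys} antiPalindromic
      w , w∈ , ys≈w = find (representatives-complete ℓ ys (ys-composition , ys-antiPalindromic))
  in subst (λ k → Any (FlipEquiv (surround (x ◂ ys ▸ y))) (representatives (suc (suc ℓ)) k)) weight
       (surround-representative 0<x 0<y x≢y w∈ ys≈w)

IsRAPCount-unique : ∀ {n ℓ r s} → IsRAPCount n ℓ r → IsRAPCount n ℓ s → r ≡ s
IsRAPCount-unique {ℓ = ℓ} (L , refl , valid , distinct , complete) (L′ , refl , valid′ , distinct′ , complete′) =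
  ≤-antisym
    (length-≤-of-covered (flipSetoid ℓ) L L′ distinct distinct′ (All.map (λ {v} → uncurry (complete′ v)) valid))
    (length-≤-of-covered (flipSetoid ℓ) L′ L distinct′ distinct (All.map (λ {v} → uncurry (complete v)) valid′))

rapCount : ℕ → ℕ → ℕ
rapCount n ℓ = length (representatives ℓ n)

representatives-isRAPCount : ∀ n ℓ → IsRAPCount n ℓ (rapCount n ℓ)
representatives-isRAPCount n ℓ =
  representatives ℓ n , refl , representatives-valid ℓ n , representatives-inequivalent ℓ n ,
  λ v → curry (representatives-complete ℓ v)

rapCount-recurrence : ∀ m ℓ →
  rapCount (3 + m) (2 + ℓ) + rapCount m (2 + ℓ) ≡
  rapCount (2 + m) (2 + ℓ) + rapCount (1 + m) (2 + ℓ) + rapCount m ℓ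
rapCount-recurrence m ℓ = begin
  length (map surround (I (3 + m))) + length (map surround (I m))
    ≡⟨ cong₂ _+_ (length-map surround (I (3 + m))) (length-map surround (I m)) ⟩
  length (I (3 + m)) + length (I m)
    ≡⟨ length-increasingFramings-recurrence (representatives ℓ) m ⟩
  length (I (2 + m)) + length (I (1 + m)) + rapCount m ℓ
    ≡⟨ cong₂ (λ p q → p + q + rapCount m ℓ)
             (length-map surround (I (2 + m))) (length-map surround (I (1 + m))) ⟨
  length (map surround (I (2 + m))) + length (map surround (I (1 + m))) + rapCount m ℓ ∎
  where
  open ≡-Reasoning
  I = increasingFramings (representatives ℓ)

-- The generating function

shiftCoeff-cong : ∀ a b {F G : ℕ → ℕ → ℤ} → (∀ x y → F x y ≡ G x y) → ∀ n k →
  shiftCoeff a b F n k ≡ shiftCoeff a b G n k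
shiftCoeff-cong a b F≡G n k with (a ≤ᵇ n) ∧ (b ≤ᵇ k)
... | true  = F≡G (n ∸ a) (k ∸ b)
... | false = refl

mulCoeff-cong : ∀ P {F G : ℕ → ℕ → ℤ} → (∀ x y → F x y ≡ G x y) → ∀ n k →
  mulCoeff P F n k ≡ mulCoeff P G n k
mulCoeff-cong []               F≡G n k = refl
mulCoeff-cong (mono c a b ∷ P) F≡G n k =
  cong₂ ℤ._+_ (cong (c ℤ.*_) (shiftCoeff-cong a b F≡G n k)) (mulCoeff-cong P F≡G n k)

mulCoeff-denominator : ∀ (F : ℕ → ℕ → ℤ) m ℓ → mulCoeff denominator F (3 + m) (2 + ℓ) ≡
  (F (3 + m) (2 + ℓ) ℤ.+ F m (2 + ℓ)) ℤ.- (F (2 + m) (2 + ℓ) ℤ.+ F (1 + m) (2 + ℓ) ℤ.+ F m ℓ)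
mulCoeff-denominator F m ℓ =
  signedSum (F (3 + m) (2 + ℓ)) (F (2 + m) (2 + ℓ)) (F (1 + m) (2 + ℓ)) (F m (2 + ℓ)) (F m ℓ)
  where
  signedSum : ∀ a b c d e →
    + 1 ℤ.* a ℤ.+ (ℤ.- + 1 ℤ.* b ℤ.+ (ℤ.- + 1 ℤ.* c ℤ.+ (+ 1 ℤ.* d ℤ.+ (ℤ.- + 1 ℤ.* e ℤ.+ 0ℤ)))) ≡
    (a ℤ.+ d) ℤ.- (b ℤ.+ c ℤ.+ e)
  signedSum = ℤ-Solver.solve-∀

denominator-annihilates-rapCount : ∀ m ℓ →
  mulCoeff denominator (λ a b → + rapCount a b) (3 + m) (2 + ℓ) ≡ 0ℤ
denominator-annihilates-rapCount m ℓ =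
  trans (mulCoeff-denominator (λ a b → + rapCount a b) m ℓ) (i≡j⇒i-j≡0 (begin
    + r₃ ℤ.+ + r₀            ≡⟨ pos-+ r₃ r₀ ⟨
    + (r₃ + r₀)              ≡⟨ cong +_ (rapCount-recurrence m ℓ) ⟩
    + (r₂ + r₁ + s)          ≡⟨ pos-+ (r₂ + r₁) s ⟩
    + (r₂ + r₁) ℤ.+ + s      ≡⟨ cong (ℤ._+ + s) (pos-+ r₂ r₁) ⟩
    + r₂ ℤ.+ + r₁ ℤ.+ + s    ∎))
  where
  open ≡-Reasoning
  r₃ = rapCount (3 + m) (2 + ℓ)
  r₂ = rapCount (2 + m) (2 + ℓ)
  r₁ = rapCount (1 + m) (2 + ℓ)
  r₀ = rapCount m (2 + ℓ)
  s  = rapCount m ℓ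

numerator-vanishes : ∀ m ℓ → polyCoeff numerator (3 + m) (2 + ℓ) ≡ 0ℤ
numerator-vanishes zero    ℓ = refl
numerator-vanishes (suc m) ℓ = refl

rapCount-generatingFunction : ∀ n ℓ →
  mulCoeff denominator (λ a b → + rapCount a b) n ℓ ≡ polyCoeff numerator n ℓ
rapCount-generatingFunction 0                   0             = refl
rapCount-generatingFunction 1                   0             = refl
rapCount-generatingFunction 2                   0             = refl
rapCount-generatingFunction 3                   0             = refl
rapCount-generatingFunction (suc (suc (suc (suc m)))) 0       = refl
rapCount-generatingFunction 0                   1             = refl
rapCount-generatingFunction 1                   1             = refl
rapCount-generatingFunction 2                   1             = refl
rapCount-generatingFunction 3                   1             = refl
rapCount-generatingFunction (suc (suc (suc (suc m)))) 1       = refl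
rapCount-generatingFunction 0                   (suc (suc ℓ)) = refl
rapCount-generatingFunction 1                   (suc (suc ℓ)) = refl
rapCount-generatingFunction 2                   (suc (suc ℓ)) = refl
rapCount-generatingFunction (suc (suc (suc m))) (suc (suc ℓ)) =
  trans (denominator-annihilates-rapCount m ℓ) (sym (numerator-vanishes m ℓ))

corollary2p9 :
    ((n ℓ : ℕ) → Σ ℕ (IsRAPCount n ℓ))
    × ((r : ℕ → ℕ → ℕ) → ((n ℓ : ℕ) → IsRAPCount n ℓ (r n ℓ)) →
        (n ℓ : ℕ) →
          mulCoeff denominator (λ a b → + (r a b)) n ℓ ≡ polyCoeff numerator n ℓ)
corollary2p9 = (λ n ℓ → rapCount n ℓ , representatives-isRAPCount n ℓ) , generatingFunction
  where
  generatingFunction : ∀ r → (∀ n ℓ → IsRAPCount n ℓ (r n ℓ)) → ∀ n ℓ →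
    mulCoeff denominator (λ a b → + r a b) n ℓ ≡ polyCoeff numerator n ℓ
  generatingFunction r isCount n ℓ = begin
    mulCoeff denominator (λ a b → + r a b) n ℓ
      ≡⟨ mulCoeff-cong denominator (λ a b → cong +_ (uniqueCount a b)) n ℓ ⟩
    mulCoeff denominator (λ a b → + rapCount a b) n ℓ
      ≡⟨ rapCount-generatingFunction n ℓ ⟩
    polyCoeff numerator n ℓ ∎
    where
    open ≡-Reasoning
    uniqueCount : ∀ a b → r a b ≡ rapCount a b
    uniqueCount a b = IsRAPCount-unique (isCount a b) (representatives-isRAPCount a b)
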